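{- Let $G$ be the graph on vertices $\{a,b,c,d,e,f,g,h,i,j,k\}$ with neighborhoods $N(a)=\{b,c\}$, $N(b)=\{a,c,d,e\}$, $N(c)=\{a,b,f,g\}$, $N(d)=\{b,e,h\}$, $N(e)=\{b,d,f,i\}$, $N(f)=\{c,e,g,i\}$, $N(g)=\{c,f,j\}$, $N(h)=\{d,i,k\}$, $N(i)=\{e,f,h,j,k\}$, $N(j)=\{g,i,k\}$, $N(k)=\{h,i,j\}$. Then the core of $G$ is a union of quadrilaterals and triangles, but there are two vertices of $G$ at distance greater than $3$.
   Context: The core of a graph is the subgraph consisting of the vertices and edges lying on cycles of the graph. "The core is a union of quadrilaterals and triangles" means the core is the union of cycles of length $4$ and $3$ contained in the graph. -}

module Defs where

open import Data.Nat using (ℕ; zero; suc; _≤_)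
open import Data.Fin using (Fin; suc)
open import Data.Fin.Patterns
open import Data.List using (List; []; _∷_; _++_; length)
open import Data.List.Membership.Propositional using (_∈_)
open import Data.List.Relation.Unary.Unique.Propositional using (Unique)
open import Data.Product using (Σ; ∃; ∃-syntax; _×_; _,_)
open import Data.Sum using (_⊎_)
open import Data.Empty using (⊥)
open import Relation.Binary.PropositionalEquality using (_≡_)

module GraphNotions {n : ℕ} (Adj : Fin n → Fin n → Set) where

  V : Set
  V = Fin n

  data Chain : List V → Set where
    chain[]  : Chain []
    chain[_] : ∀ x → Chain (x ∷ [])
    chain∷   : ∀ {x y xs} → Adj x y → Chain (y ∷ xs) → Chain (x ∷ y ∷ xs)

  closed : List V → List V
  closed []       = []
  closed (v ∷ rs) = v ∷ rs ++ v ∷ []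

  -- A cycle is a list of k ≥ 3 distinct vertices v₁ … v_k with
  -- v₁v₂, …, v_{k-1}v_k, v_kv₁ all edges.
  IsCycle : List V → Set
  IsCycle []       = ⊥
  IsCycle (v ∷ rs) = (2 ≤ length rs) × Unique (v ∷ rs) × Chain (closed (v ∷ rs))

  EdgeOf : V → V → List V → Set
  EdgeOf u v cs = ∃[ pre ] ∃[ post ]
    (closed cs ≡ pre ++ u ∷ v ∷ post ⊎ closed cs ≡ pre ++ v ∷ u ∷ post)

  -- the core: vertices and edges lying on cycles
  CoreVertex : V → Set
  CoreVertex v = ∃[ cs ] IsCycle cs × v ∈ cs

  CoreEdge : V → V → Set
  CoreEdge u v = ∃[ cs ] IsCycle cs × EdgeOf u v cs

  Short : List V → Set
  Short cs = IsCycle cs × (length cs ≡ 3 ⊎ length cs ≡ 4)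

  TriQuadVertex : V → Set
  TriQuadVertex v = ∃[ cs ] Short cs × v ∈ cs

  TriQuadEdge : V → V → Set
  TriQuadEdge u v = ∃[ cs ] Short cs × EdgeOf u v cs

  CoreIsUnionOfTrianglesAndQuadrilaterals : Set
  CoreIsUnionOfTrianglesAndQuadrilaterals =
    (∀ v → (CoreVertex v → TriQuadVertex v) × (TriQuadVertex v → CoreVertex v)) ×
    (∀ u v → (CoreEdge u v → TriQuadEdge u v) × (TriQuadEdge u v → CoreEdge u v))

  data Walk : V → V → ℕ → Set where
    here : ∀ {u} → Walk u u zero
    step : ∀ {u w v k} → Adj u w → Walk w v k → Walk u v (suc k)

  -- distance greater than d: no walk (equivalently path) of length ≤ d
  DistGreaterThan : V → V → ℕ → Set
  DistGreaterThan u v d = ∀ k → k ≤ d → Walk u v k → ⊥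

-- The specific graph G.  a..k = 0..10.

pattern 10F = suc 9F

N : Fin 11 → List (Fin 11)
N 0F  = 1F ∷ 2F ∷ []
N 1F  = 0F ∷ 2F ∷ 3F ∷ 4F ∷ []
N 2F  = 0F ∷ 1F ∷ 5F ∷ 6F ∷ []
N 3F  = 1F ∷ 4F ∷ 7F ∷ []
N 4F  = 1F ∷ 3F ∷ 5F ∷ 8F ∷ []
N 5F  = 2F ∷ 4F ∷ 6F ∷ 8F ∷ []
N 6F  = 2F ∷ 5F ∷ 9F ∷ []
N 7F  = 3F ∷ 8F ∷ 10F ∷ []
N 8F  = 4F ∷ 5F ∷ 7F ∷ 9F ∷ 10F ∷ []
N 9F  = 6F ∷ 8F ∷ 10F ∷ []
N 10F = 7F ∷ 8F ∷ 9F ∷ []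

AdjG : Fin 11 → Fin 11 → Set
AdjG u v = v ∈ N u

open GraphNotions AdjG public

-- Every vertex and every edge of G lies on one of nine explicit triangles and quadrilaterals,
-- and every edge of a cycle is an edge of G; so the core is all of G and equals that union.
-- For the distance, the distance to k drops by at most one along each edge and is 4 at a,
-- so no walk from a to k has length at most 3.
module Submission where

open import Defs using (module GraphNotions; N; AdjG; 10F)
open import Data.Nat using (ℕ; suc; s≤s; _+_; _≤_; _<_; _≤?_; _≟_)
open import Data.Nat.Properties using (≤-refl; ≤-trans; +-monoˡ-≤; <-irrefl; ≤-<-trans)
open import Data.Fin using (Fin) renaming (_≟_ to _≟ᶠ_)
open import Data.Fin.Patterns
open import Data.List using (List; []; _∷_; _++_; length; allFin)
open import Data.List.Membership.Propositional using (_∈_)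
open import Data.List.Membership.Propositional.Properties using (∈-allFin)
import Data.List.Membership.DecPropositional as DecMembership
open import Data.List.Relation.Unary.All as All using (All; lookup; lookupAny; all?)
open import Data.List.Relation.Unary.Any as Any using (Any; here; there; any?)
open import Data.List.Relation.Unary.Unique.DecPropositional using (unique?)
open import Data.Product using (_×_; ∃-syntax; _,_)
open import Data.Product.Properties using (≡-dec)
open import Data.Sum using (_⊎_; inj₁; inj₂)
open import Relation.Nullary using (Dec; yes; no)
open import Relation.Nullary.Decidable using (from-yes; _×-dec_; _⊎-dec_)
open import Relation.Binary.PropositionalEquality using (_≡_; refl; cong; subst)

consecutivePairs : {A : Set} → List A → List (A × A)
consecutivePairs (x ∷ y ∷ xs) = (x , y) ∷ consecutivePairs (y ∷ xs)
consecutivePairs _            = []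

∈-consecutivePairs⇒split : {A : Set} {u v : A} (xs : List A) → (u , v) ∈ consecutivePairs xs →
                           ∃[ pre ] ∃[ post ] xs ≡ pre ++ u ∷ v ∷ post
∈-consecutivePairs⇒split (x ∷ y ∷ xs) (here refl) = [] , xs , refl
∈-consecutivePairs⇒split (x ∷ y ∷ xs) (there p) with ∈-consecutivePairs⇒split (y ∷ xs) p
... | pre , post , eq = x ∷ pre , post , cong (x ∷_) eq

module Cycles {n : ℕ} (Adj : Fin n → Fin n → Set) where
  open GraphNotions Adj

  chain-adjacent : ∀ pre {u v post} → Chain (pre ++ u ∷ v ∷ post) → Adj u v
  chain-adjacent []            (chain∷ a _) = a
  chain-adjacent (_ ∷ [])      (chain∷ _ c) = chain-adjacent [] c
  chain-adjacent (_ ∷ y ∷ pre) (chain∷ _ c) = chain-adjacent (y ∷ pre) c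

  cycle-edge-adjacent : ∀ {u v} cs → IsCycle cs → EdgeOf u v cs → Adj u v ⊎ Adj v u
  cycle-edge-adjacent (_ ∷ _) (_ , _ , c) (pre , _ , inj₁ eq) = inj₁ (chain-adjacent pre (subst Chain eq c))
  cycle-edge-adjacent (_ ∷ _) (_ , _ , c) (pre , _ , inj₂ eq) = inj₂ (chain-adjacent pre (subst Chain eq c))

  triQuadEdge-sym : ∀ {u v} → TriQuadEdge u v → TriQuadEdge v u
  triQuadEdge-sym (cs , s , pre , post , inj₁ eq) = cs , s , pre , post , inj₂ eq
  triQuadEdge-sym (cs , s , pre , post , inj₂ eq) = cs , s , pre , post , inj₁ eq

  core≡triQuad : (∀ v → TriQuadVertex v) → (∀ u v → Adj u v → TriQuadEdge u v) →
                 CoreIsUnionOfTrianglesAndQuadrilaterals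
  core≡triQuad onShortVertex onShortEdge =
      (λ v → (λ _ → onShortVertex v) , λ { (cs , (c , _) , v∈) → cs , c , v∈ })
    , (λ u v → coreEdge u v , λ { (cs , (c , _) , e) → cs , c , e })
    where
    coreEdge : ∀ u v → CoreEdge u v → TriQuadEdge u v
    coreEdge u v (cs , c , e) with cycle-edge-adjacent cs c e
    ... | inj₁ uv = onShortEdge u v uv
    ... | inj₂ vu = triQuadEdge-sym (onShortEdge v u vu)

  TraversesEdge : V → V → List V → Set
  TraversesEdge u v cs = (u , v) ∈ consecutivePairs (closed cs) ⊎ (v , u) ∈ consecutivePairs (closed cs)

  traversesEdge⇒edgeOf : ∀ {u v} cs → TraversesEdge u v cs → EdgeOf u v cs
  traversesEdge⇒edgeOf cs (inj₁ uv) with ∈-consecutivePairs⇒split (closed cs) uv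
  ... | pre , post , eq = pre , post , inj₁ eq
  traversesEdge⇒edgeOf cs (inj₂ vu) with ∈-consecutivePairs⇒split (closed cs) vu
  ... | pre , post , eq = pre , post , inj₂ eq

  module _ {cycles : List (List V)} (short : All Short cycles) where

    triQuadVertex-fromList : ∀ {v} → Any (v ∈_) cycles → TriQuadVertex v
    triQuadVertex-fromList i = Any.lookup i , lookupAny short i

    triQuadEdge-fromList : ∀ {u v} → Any (TraversesEdge u v) cycles → TriQuadEdge u v
    triQuadEdge-fromList i with lookupAny short i
    ... | s , t = Any.lookup i , s , traversesEdge⇒edgeOf (Any.lookup i) t

  walk⇒potential-≤ : (f : V → ℕ) → (∀ {u w} → Adj u w → f u ≤ suc (f w)) →
                   ∀ {u v k} → Walk u v k → f u ≤ k + f v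
  walk⇒potential-≤ f lipschitz here       = ≤-refl
  walk⇒potential-≤ f lipschitz (step a p) = ≤-trans (lipschitz a) (s≤s (walk⇒potential-≤ f lipschitz p))

  distGreaterThan-potential : (f : V → ℕ) → (∀ {u w} → Adj u w → f u ≤ suc (f w)) →
                              ∀ {u v d} → d + f v < f u → DistGreaterThan u v d
  distGreaterThan-potential f lipschitz {v = v} gap k k≤d p =
    <-irrefl refl (≤-<-trans (≤-trans (walk⇒potential-≤ f lipschitz p) (+-monoˡ-≤ (f v) k≤d)) gap)

  module Decide (Adj? : ∀ u v → Dec (Adj u v)) where
    open DecMembership (≡-dec (_≟ᶠ_ {n}) (_≟ᶠ_ {n})) using () renaming (_∈?_ to _∈ₑ?_)

    chain? : ∀ xs → Dec (Chain xs)
    chain? []           = yes chain[]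
    chain? (x ∷ [])     = yes chain[ x ]
    chain? (x ∷ y ∷ xs) with Adj? x y | chain? (y ∷ xs)
    ... | yes a | yes c = yes (chain∷ a c)
    ... | no ¬a | _     = no λ { (chain∷ a _) → ¬a a }
    ... | yes _ | no ¬c = no λ { (chain∷ _ c) → ¬c c }

    short? : ∀ cs → Dec (Short cs)
    short? []       = no λ { (() , _) }
    short? (v ∷ rs) =
      ((2 ≤? length rs) ×-dec unique? (_≟ᶠ_ {n}) (v ∷ rs) ×-dec chain? (closed (v ∷ rs)))
      ×-dec (length (v ∷ rs) ≟ 3 ⊎-dec length (v ∷ rs) ≟ 4)

    traversesEdge? : ∀ u v cs → Dec (TraversesEdge u v cs)
    traversesEdge? u v cs =
      ((u , v) ∈ₑ? consecutivePairs (closed cs)) ⊎-dec ((v , u) ∈ₑ? consecutivePairs (closed cs))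

open Cycles AdjG
open GraphNotions AdjG
open DecMembership (_≟ᶠ_ {11}) using (_∈?_)
open Decide (λ u v → v ∈? N u)

forEachVertex : {P : Fin 11 → Set} → All P (allFin 11) → ∀ v → P v
forEachVertex all v = lookup all (∈-allFin v)

forEachEdge : {P : Fin 11 → Fin 11 → Set} → All (λ u → All (P u) (N u)) (allFin 11) →
              ∀ {u v} → AdjG u v → P u v
forEachEdge all {u} v∈Nu = lookup (forEachVertex all u) v∈Nu

shortCycles : List (List (Fin 11))
shortCycles =
  (0F ∷ 1F ∷ 2F ∷ []) ∷ (1F ∷ 3F ∷ 4F ∷ []) ∷ (2F ∷ 5F ∷ 6F ∷ []) ∷ (3F ∷ 7F ∷ 8F ∷ 4F ∷ []) ∷
  (4F ∷ 5F ∷ 8F ∷ []) ∷ (7F ∷ 8F ∷ 10F ∷ []) ∷ (8F ∷ 9F ∷ 10F ∷ []) ∷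
  (1F ∷ 2F ∷ 5F ∷ 4F ∷ []) ∷ (6F ∷ 9F ∷ 8F ∷ 5F ∷ []) ∷ []

shortCycles-short : All Short shortCycles
shortCycles-short = from-yes (all? short? shortCycles)

every-vertex-on-shortCycle : ∀ v → TriQuadVertex v
every-vertex-on-shortCycle =
  forEachVertex (All.map (triQuadVertex-fromList shortCycles-short)
    (from-yes (all? (λ v → any? (v ∈?_) shortCycles) (allFin 11))))

every-edge-on-shortCycle : ∀ u v → AdjG u v → TriQuadEdge u v
every-edge-on-shortCycle _ _ =
  forEachEdge (All.map (All.map (triQuadEdge-fromList shortCycles-short))
    (from-yes (all? (λ u → all? (λ v → any? (traversesEdge? u v) shortCycles) (N u)) (allFin 11))))

distanceTo-k : Fin 11 → ℕ
distanceTo-k 0F  = 4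
distanceTo-k 1F  = 3
distanceTo-k 2F  = 3
distanceTo-k 3F  = 2
distanceTo-k 4F  = 2
distanceTo-k 5F  = 2
distanceTo-k 6F  = 2
distanceTo-k 7F  = 1
distanceTo-k 8F  = 1
distanceTo-k 9F  = 1
distanceTo-k 10F = 0

distanceTo-k-lipschitz : ∀ {u w} → AdjG u w → distanceTo-k u ≤ suc (distanceTo-k w)
distanceTo-k-lipschitz = forEachEdge
  (from-yes (all? (λ u → all? (λ w → distanceTo-k u ≤? suc (distanceTo-k w)) (N u)) (allFin 11)))

mainTheorem4 : CoreIsUnionOfTrianglesAndQuadrilaterals × (∃[ u ] ∃[ v ] DistGreaterThan u v 3)
mainTheorem4 =
    core≡triQuad every-vertex-on-shortCycle every-edge-on-shortCycle
  , 0F , 10F , distGreaterThan-potential distanceTo-k distanceTo-k-lipschitz ≤-refl
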